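{- Let $A$ be a finite abelian group of even order and $H$ a subgroup of $A$ such that every element of $H$ is a square in $A$. Then $H$ is a subgroup perfect code of $A$ if and only if $H=\{2a:a\in A\}$.
   Context: Groups are written additively. An element $x\in A$ is a square if $x=2y$ for some $y\in A$; a subset is square-free if it contains no squares. For a square-free $T\subseteq A$, $\mathrm{CayS}(A,T)$ is the simple graph with vertex set $A$ where distinct $x,y$ are adjacent iff $x+y\in T$. A subset $C$ of vertices of a graph is a perfect code if every vertex is at distance at most one from exactly one vertex of $C$. A subgroup $H$ of $A$ is a subgroup perfect code of $A$ if $H$ is a perfect code of $\mathrm{CayS}(A,T)$ for some square-free $T\subseteq A$. -}

module Defs where

open import Level using (Level; _⊔_)
open import Data.Bool using (Bool; true)
open import Data.Fin using (Fin)
open import Data.Nat using (ℕ)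
open import Data.Product using (Σ; ∃; _×_; _,_)
open import Data.Sum using (_⊎_)
open import Relation.Nullary using (¬_)
open import Relation.Binary.PropositionalEquality as ≡ using (_≡_)
open import Function.Bundles using (Inverse)
open import Algebra.Bundles using (AbelianGroup)

HasOrder : ∀ {c ℓ} → AbelianGroup c ℓ → ℕ → Set (c ⊔ ℓ)
HasOrder G n = Inverse (AbelianGroup.setoid G) (≡.setoid (Fin n))

module _ {c ℓ} (G : AbelianGroup c ℓ) where
  open AbelianGroup G renaming (_∙_ to _+_; ε to 0#; _⁻¹ to -_)

  Subset : Set c
  Subset = Carrier → Bool

  _∈_ : Carrier → Subset → Set
  x ∈ S = S x ≡ true

  RespectsEq : Subset → Set (c ⊔ ℓ)
  RespectsEq S = ∀ {x y} → x ≈ y → S x ≡ S y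

  IsSubgroup : Subset → Set (c ⊔ ℓ)
  IsSubgroup H = RespectsEq H × (0# ∈ H)
               × (∀ x y → x ∈ H → y ∈ H → (x + y) ∈ H)
               × (∀ x → x ∈ H → (- x) ∈ H)

  IsSquare : Carrier → Set (c ⊔ ℓ)
  IsSquare x = ∃ λ y → x ≈ y + y

  SquareFree : Subset → Set (c ⊔ ℓ)
  SquareFree T = ∀ x → x ∈ T → ¬ IsSquare x

  -- adjacency in the Cayley sum graph CayS(A,T)
  Adj : Subset → Carrier → Carrier → Set ℓ
  Adj T x y = (¬ (x ≈ y)) × ((x + y) ∈ T)

  Within1 : Subset → Carrier → Carrier → Set ℓ
  Within1 T c v = (c ≈ v) ⊎ Adj T c v

  IsPerfectCode : Subset → Subset → Set (c ⊔ ℓ)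
  IsPerfectCode T C = ∀ v → ∃ λ c → (c ∈ C) × Within1 T c v
                        × (∀ c' → c' ∈ C → Within1 T c' v → c' ≈ c)

  IsSubgroupPerfectCode : Subset → Set (c ⊔ ℓ)
  IsSubgroupPerfectCode H = IsSubgroup H
    × ∃ λ (T : Subset) → RespectsEq T × SquareFree T × IsPerfectCode T H

  IsSetOfSquares : Subset → Set (c ⊔ ℓ)
  IsSetOfSquares H = ∀ x → (x ∈ H → IsSquare x) × (IsSquare x → x ∈ H)

module Submission where

-- (⇒) Suppose H ⊆ 2A is a perfect code of CayS(A,T) with T square-free, and
--     let x be a square.  Some c ∈ H is within distance one of x.  If c were
--     adjacent to x then c + x ∈ T; but c is a square too, and a sum of
--     squares is a square, contradicting square-freeness.  Hence x = c ∈ H.  Any set T that meets every non-trivial coset of H in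
--     exactly one element and avoids H makes H a perfect code of CayS(A,T)
--     (vertices of H cover themselves; v ∉ H is covered only by t - v, where
--     t is the element of T in v + H).  Such a T is square-free, since it
--     avoids H = 2A.  In a finite group such a T exists: take in every
--     non-trivial coset its element of least index in an enumeration.

open import Defs
open import Level using (_⊔_; 0ℓ)
open import Data.Nat using (ℕ; suc; z≤n; s≤s)
open import Data.Nat.Divisibility using (_∣_)
open import Data.Bool using (true)
open import Data.Bool.Properties using (_≟_)
open import Data.Fin using (Fin; _≤_) renaming (zero to fzero; suc to fsuc)
open import Data.Fin.Properties using (all?; _≤?_; ≤-antisym)
open import Data.Product using (_×_; _,_; ∃; proj₁; proj₂)
open import Data.Sum using (inj₁; inj₂)
open import Function using (_∘_)
open import Function.Bundles using (Inverse; _⇔_; mk⇔)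
open import Relation.Nullary using (¬_; Dec; yes; no; does; ¬?; _×-dec_; _→-dec_; contradiction)
open import Relation.Nullary.Decidable using (dec-true; does-⇔)
open import Relation.Unary using (Pred)
import Relation.Unary as U
open import Relation.Binary using (Setoid; Rel; IsEquivalence; _⇒_)
import Relation.Binary as B
open import Relation.Binary.PropositionalEquality as ≡ using (_≡_)
open import Algebra.Bundles using (AbelianGroup; CommutativeMonoid)
import Algebra.Properties.AbelianGroup as AbelianGroupProperties
import Algebra.Properties.Group as GroupProperties
import Algebra.Properties.CommutativeSemigroup as CommutativeSemigroupProperties
import Relation.Binary.Reasoning.Setoid as SetoidReasoning

from-does : ∀ {a} {A : Set a} (a? : Dec A) → does a? ≡ true → A
from-does (yes a) _ = a

least-witness : ∀ {n p} {P : Pred (Fin n) p} → U.Decidable P →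
                ∀ {j} → P j → ∃ λ i → P i × (∀ k → P k → i ≤ k)
least-witness {suc n} {P = P} P? pj with P? fzero
... | yes p₀ = fzero , p₀ , λ _ _ → z≤n
least-witness {suc n} {P = P} P? {fzero}  pj | no ¬p₀ = contradiction pj ¬p₀
least-witness {suc n} {P = P} P? {fsuc j} pj | no ¬p₀ with least-witness (P? ∘ fsuc) pj
... | i , pᵢ , minimal = fsuc i , pᵢ , bound
  where
  bound : ∀ k → P k → fsuc i ≤ k
  bound fzero    p₀ = contradiction p₀ ¬p₀
  bound (fsuc k) pₖ = s≤s (minimal k pₖ)

module LeastRepresentatives
  {c ℓ r} {S : Setoid c ℓ} {n : ℕ} (enum : Inverse S (≡.setoid (Fin n)))
  {_∼_ : Rel (Setoid.Carrier S) r} (∼-equiv : IsEquivalence _∼_)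
  (≈⇒∼ : Setoid._≈_ S ⇒ _∼_) (_∼?_ : B.Decidable _∼_)
  where

  open Setoid S using (Carrier; _≈_)
  open Inverse enum using (to; from; to-cong; from-cong; strictlyInverseˡ; strictlyInverseʳ)
  open IsEquivalence ∼-equiv renaming (sym to ∼-sym; trans to ∼-trans)

  IsLeast : Carrier → Set r
  IsLeast x = ∀ k → from k ∼ x → to x ≤ k

  isLeast? : ∀ x → Dec (IsLeast x)
  isLeast? x = all? λ k → (from k ∼? x) →-dec (to x ≤? k)

  isLeast-resp : ∀ {x y} → x ≈ y → IsLeast x → IsLeast y
  isLeast-resp {x} {y} x≈y least k k∼y =
    ≡.subst (_≤ k) (to-cong x≈y) (least k (∼-trans k∼y (∼-sym (≈⇒∼ x≈y))))

  least-exists : ∀ x → ∃ λ y → y ∼ x × IsLeast y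
  least-exists x with least-witness (λ k → from k ∼? x) (≈⇒∼ (strictlyInverseʳ x))
  ... | i , i∼x , minimal = from i , i∼x , least
    where
    least : IsLeast (from i)
    least k k∼i = ≡.subst (_≤ k) (≡.sym (strictlyInverseˡ i)) (minimal k (∼-trans k∼i i∼x))

  least-unique : ∀ {x y} → x ∼ y → IsLeast x → IsLeast y → x ≈ y
  least-unique {x} {y} x∼y least-x least-y = begin
    x             ≈⟨ strictlyInverseʳ x ⟨
    from (to x)   ≈⟨ from-cong same-index ⟩
    from (to y)   ≈⟨ strictlyInverseʳ y ⟩
    y             ∎
    where
    open SetoidReasoning S
    same-index : to x ≡ to y
    same-index = ≤-antisym
      (least-x (to y) (∼-trans (≈⇒∼ (strictlyInverseʳ y)) (∼-sym x∼y)))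
      (least-y (to x) (∼-trans (≈⇒∼ (strictlyInverseʳ x)) x∼y))

module _ {c ℓ} (G : AbelianGroup c ℓ) where

  open AbelianGroup G
    renaming (_∙_ to _+_; ε to 0#; _⁻¹ to -_; refl to ≈-refl; sym to ≈-sym)
  open GroupProperties group using (//-rightDividesˡ; //-rightDividesʳ; x≈y⇒x∙y⁻¹≈ε)
  open AbelianGroupProperties G using (⁻¹-anti-homo‿-)
  open CommutativeSemigroupProperties (CommutativeMonoid.commutativeSemigroup commutativeMonoid)
    using (interchange)
  open SetoidReasoning setoid

  square-+ : ∀ {x y} → IsSquare G x → IsSquare G y → IsSquare G (x + y)
  square-+ {x} {y} (a , x≈2a) (b , y≈2b) = a + b , (begin
    x + y              ≈⟨ ∙-cong x≈2a y≈2b ⟩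
    (a + a) + (b + b)  ≈⟨ interchange a a b b ⟩
    (a + b) + (a + b)  ∎)

  -- A perfect code of a Cayley sum graph with square-free connection set
  -- that consists of squares contains every square: a square can only be
  -- covered by itself, since a code element adjacent to it would put a
  -- square (their sum) into the connection set.
  code-contains-squares : ∀ {T C} → RespectsEq G C → SquareFree G T → IsPerfectCode G T C →
                          (∀ x → _∈_ G x C → IsSquare G x) →
                          ∀ x → IsSquare G x → _∈_ G x C
  code-contains-squares C-resp T-sf code C⊆2A x x-sq with code x
  ... | c , c∈C , inj₁ c≈x , _ = ≡.trans (≡.sym (C-resp c≈x)) c∈C
  ... | c , c∈C , inj₂ (_ , c+x∈T) , _ = contradiction (square-+ (C⊆2A c c∈C) x-sq) (T-sf _ c+x∈T)

  module Cosets (H : Subset G) (H-subgroup : IsSubgroup G H) where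

    H-resp : RespectsEq G H
    H-resp = proj₁ H-subgroup

    H-0 : _∈_ G 0# H
    H-0 = proj₁ (proj₂ H-subgroup)

    H-+ : ∀ {x y} → _∈_ G x H → _∈_ G y H → _∈_ G (x + y) H
    H-+ = proj₁ (proj₂ (proj₂ H-subgroup)) _ _

    H-neg : ∀ {x} → _∈_ G x H → _∈_ G (- x) H
    H-neg = proj₂ (proj₂ (proj₂ H-subgroup)) _

    H-resp∈ : ∀ {x y} → x ≈ y → _∈_ G x H → _∈_ G y H
    H-resp∈ x≈y x∈H = ≡.trans (≡.sym (H-resp x≈y)) x∈H

    _∈H? : ∀ x → Dec (_∈_ G x H)
    x ∈H? = H x ≟ true

    _∼_ : Rel Carrier 0ℓ
    x ∼ y = _∈_ G (x - y) H

    ≈⇒∼ : ∀ {x y} → x ≈ y → x ∼ y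
    ≈⇒∼ x≈y = H-resp∈ (≈-sym (x≈y⇒x∙y⁻¹≈ε x≈y)) H-0

    ∼-sym : ∀ {x y} → x ∼ y → y ∼ x
    ∼-sym {x} {y} x∼y = H-resp∈ (⁻¹-anti-homo‿- x y) (H-neg x∼y)

    ∼-trans : ∀ {x y z} → x ∼ y → y ∼ z → x ∼ z
    ∼-trans {x} {y} {z} x∼y y∼z = H-resp∈ telescope (H-+ x∼y y∼z)
      where
      telescope : (x - y) + (y - z) ≈ x - z
      telescope = begin
        (x - y) + (y - z)  ≈⟨ assoc (x - y) y (- z) ⟨
        ((x - y) + y) - z  ≈⟨ ∙-congʳ (//-rightDividesˡ y x) ⟩
        x - z              ∎

    ∼-isEquivalence : IsEquivalence _∼_
    ∼-isEquivalence = record { refl = ≈⇒∼ ≈-refl ; sym = ∼-sym ; trans = ∼-trans }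

    _∼?_ : B.Decidable _∼_
    x ∼? y = (x - y) ∈H?

    record IsTransversal (T : Subset G) : Set (c ⊔ ℓ) where
      field
        respects : RespectsEq G T
        avoids   : ∀ t → _∈_ G t T → ¬ _∈_ G t H
        covers   : ∀ x → ¬ _∈_ G x H → ∃ λ t → _∈_ G t T × t ∼ x
        unique   : ∀ {t t′} → _∈_ G t T → _∈_ G t′ T → t ∼ t′ → t ≈ t′

    transversal-perfectCode : ∀ {T} → IsTransversal T → IsPerfectCode G T H
    transversal-perfectCode {T} transversal v with v ∈H?
    ... | yes v∈H = v , v∈H , inj₁ ≈-refl , only-v
      where
      only-v : ∀ c → _∈_ G c H → Within1 G T c v → c ≈ v
      only-v c _   (inj₁ c≈v) = c≈v
      only-v c c∈H (inj₂ (_ , c+v∈T)) =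
        contradiction (H-+ c∈H v∈H) (IsTransversal.avoids transversal _ c+v∈T)
    ... | no v∉H with IsTransversal.covers transversal v v∉H
    ...   | t , t∈T , t∼v = t - v , t∼v , inj₂ (t-v≉v , t-v+v∈T) , only-t-v
      where
      open IsTransversal transversal
      t-v≉v : ¬ (t - v ≈ v)
      t-v≉v t-v≈v = v∉H (H-resp∈ t-v≈v t∼v)
      t-v+v∈T : _∈_ G ((t - v) + v) T
      t-v+v∈T = ≡.trans (respects (//-rightDividesˡ v t)) t∈T
      only-t-v : ∀ c → _∈_ G c H → Within1 G T c v → c ≈ t - v
      only-t-v c c∈H (inj₁ c≈v) = contradiction (H-resp∈ c≈v c∈H) v∉H
      only-t-v c c∈H (inj₂ (_ , c+v∈T)) = begin
        c            ≈⟨ //-rightDividesʳ v c ⟨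
        (c + v) - v  ≈⟨ ∙-congʳ c+v≈t ⟩
        t - v        ∎
        where
        c+v∼v : (c + v) ∼ v
        c+v∼v = H-resp∈ (≈-sym (//-rightDividesʳ v c)) c∈H
        c+v≈t : c + v ≈ t
        c+v≈t = unique c+v∈T t∈T (∼-trans c+v∼v (∼-sym t∼v))

    transversal-squareFree : ∀ {T} → IsTransversal T → (∀ x → IsSquare G x → _∈_ G x H) →
                             SquareFree G T
    transversal-squareFree transversal 2A⊆H t t∈T t-sq =
      IsTransversal.avoids transversal t t∈T (2A⊆H t t-sq)

    module Finite {n : ℕ} (enum : HasOrder G n) where

      open LeastRepresentatives enum ∼-isEquivalence ≈⇒∼ _∼?_

      leastOutsideH? : ∀ x → Dec (¬ _∈_ G x H × IsLeast x)
      leastOutsideH? x = ¬? (x ∈H?) ×-dec isLeast? x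

      leastTransversal : Subset G
      leastTransversal x = does (leastOutsideH? x)

      leastTransversal-isTransversal : IsTransversal leastTransversal
      leastTransversal-isTransversal = record
        { respects = λ x≈y → does-⇔ (transfer x≈y) (leastOutsideH? _) (leastOutsideH? _)
        ; avoids   = λ t t∈T → proj₁ (from-does (leastOutsideH? t) t∈T)
        ; covers   = covers
        ; unique   = λ {t} {t′} t∈T t′∈T t∼t′ →
            least-unique t∼t′ (proj₂ (from-does (leastOutsideH? t) t∈T))
                               (proj₂ (from-does (leastOutsideH? t′) t′∈T))
        }
        where
        transfer : ∀ {x y} → x ≈ y → (¬ _∈_ G x H × IsLeast x) ⇔ (¬ _∈_ G y H × IsLeast y)
        transfer x≈y = mk⇔
          (λ (x∉H , least) → (x∉H ∘ H-resp∈ (≈-sym x≈y)) , isLeast-resp x≈y least)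
          (λ (y∉H , least) → (y∉H ∘ H-resp∈ x≈y) , isLeast-resp (≈-sym x≈y) least)
        covers : ∀ x → ¬ _∈_ G x H → ∃ λ t → _∈_ G t leastTransversal × t ∼ x
        covers x x∉H with least-exists x
        ... | t , t∼x , least = t , dec-true (leastOutsideH? t) (t∉H , least) , t∼x
          where
          t∉H : ¬ _∈_ G t H
          t∉H t∈H = x∉H (H-resp∈ (//-rightDividesˡ t x) (H-+ (∼-sym t∼x) t∈H))

lemma3p5 : ∀ {c ℓ} (G : AbelianGroup c ℓ) (n : ℕ) → HasOrder G n → 2 ∣ n
    → (H : Subset G) → IsSubgroup G H
    → (∀ x → _∈_ G x H → IsSquare G x)
    → (IsSubgroupPerfectCode G H → IsSetOfSquares G H)
    × (IsSetOfSquares G H → IsSubgroupPerfectCode G H)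
lemma3p5 G n enum _ H H-subgroup H⊆2A = only-squares , from-squares
  where
  open Cosets G H H-subgroup
  open Finite enum

  only-squares : IsSubgroupPerfectCode G H → IsSetOfSquares G H
  only-squares (_ , T , _ , T-squareFree , code) x =
    H⊆2A x , code-contains-squares G H-resp T-squareFree code H⊆2A x

  from-squares : IsSetOfSquares G H → IsSubgroupPerfectCode G H
  from-squares H=2A = H-subgroup , leastTransversal
    , IsTransversal.respects leastTransversal-isTransversal
    , transversal-squareFree leastTransversal-isTransversal (λ x → proj₂ (H=2A x))
    , transversal-perfectCode leastTransversal-isTransversal
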